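{- Let $T$ and $T'$ be successive Hydras in an arbitrary battle (i.e. $T'$ is obtained from $T$ by a battle step at some stage), and let $H,H'\in\mathcal{T}_{\mathcal{H}}$ be encodings of $T$ and $T'$. Then there is a ground term $n$ over $\{\mathsf{0},\mathsf{s}\}$ such that $\mathsf{A}(n,H)\to^{+}_{\mathcal{H}/\mathrm{AC}}\mathsf{A}(\mathsf{s}(n),H')$.
   Context: Terms are built from variables and the function symbols: constants $\mathsf{h},\mathsf{0}$; unary $\mathsf{I},\mathsf{E},\mathsf{s}$; binary $\mathsf{A},\mathsf{B},\mathsf{C},\mathsf{D}$ and binary $\mid$ written infix. $=_{\mathrm{AC}}$ is the congruence generated by associativity and commutativity of $\mid$. For a set $\mathcal{R}$ of rules, $\to_{\mathcal{R}}$ is its closure under substitutions and contexts and $\to_{\mathcal{R}/\mathrm{AC}}={=_{\mathrm{AC}}}\cdot{\to_{\mathcal{R}}}\cdot{=_{\mathrm{AC}}}$; $\to^+$ denotes the transitive closure. The TRS $\mathcal{H}$ consists of the rules: (1) $\mathsf{A}(n,\mathsf{I}(\mathsf{h}))\to\mathsf{A}(\mathsf{s}(n),\mathsf{h})$; (2) $\mathsf{A}(n,\mathsf{I}(\mathsf{h}\mid x))\to\mathsf{A}(\mathsf{s}(n),\mathsf{I}(x))$; (3) $\mathsf{A}(n,\mathsf{I}(x))\to\mathsf{B}(n,\mathsf{D}(\mathsf{s}(n),\mathsf{I}(x)))$; (4) $\mathsf{C}(\mathsf{0},x)\to\mathsf{E}(x)$; (5) $\mathsf{C}(\mathsf{s}(n),x)\to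 x\mid\mathsf{C}(n,x)$; (6) $\mathsf{I}(\mathsf{E}(x)\mid y)\to\mathsf{E}(\mathsf{I}(x\mid y))$; (7) $\mathsf{I}(\mathsf{E}(x))\to\mathsf{E}(\mathsf{I}(x))$; (8) $\mathsf{D}(n,\mathsf{I}(\mathsf{I}(x)))\to\mathsf{I}(\mathsf{D}(n,\mathsf{I}(x)))$; (9) $\mathsf{D}(n,\mathsf{I}(\mathsf{I}(x)\mid y))\to\mathsf{I}(\mathsf{D}(n,\mathsf{I}(x))\mid y)$; (10) $\mathsf{D}(n,\mathsf{I}(\mathsf{I}(\mathsf{h}\mid x)\mid y))\to\mathsf{I}(\mathsf{C}(n,\mathsf{I}(x))\mid y)$; (11) $\mathsf{D}(n,\mathsf{I}(\mathsf{I}(\mathsf{h}\mid x)))\to\mathsf{I}(\mathsf{C}(n,\mathsf{I}(x)))$; (12) $\mathsf{D}(n,\mathsf{I}(\mathsf{I}(\mathsf{h})\mid y))\to\mathsf{I}(\mathsf{C}(n,\mathsf{h})\mid y)$; (13) $\mathsf{D}(n,\mathsf{I}(\mathsf{I}(\mathsf{h})))\to\mathsf{I}(\mathsf{C}(n,\mathsf{h}))$; (14) $\mathsf{B}(n,\mathsf{E}(x))\to\mathsf{A}(\mathsf{s}(n),x)$. $\mathcal{T}_{\mathcal{H}}$ is the set of ground terms over $\{\mathsf{h},\mathsf{I},\mid\}$. A Hydra is a finite rooted unordered tree; its heads are its leaves other than the root. An encoding of a Hydra is defined recursively: a single node is encoded as $\mathsf{h}$, and a node whose subtrees are $T_1,\dots,T_k$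 ($k\ge 1$) is encoded as $\mathsf{I}(t_1\mid\cdots\mid t_k)$ with $t_i$ an encoding of $T_i$ (encodings are unique up to $=_{\mathrm{AC}}$). A battle step at stage $n\in\mathbb{N}$ transforms a Hydra $T$ with at least one head into $T'$: choose any head $\ell$, with parent $p$, and delete $\ell$; if $p$ is the root, the result is $T'$; otherwise, let $g$ be the parent of $p$ and $P$ the subtree rooted at $p$ after the deletion, and obtain $T'$ by replacing $P$, as a child subtree of $g$, by $n+2$ copies of $P$. A battle is a sequence $T_0,T_1,\dots$ of Hydras in which $T_{n+1}$ is obtained from $T_n$ by a battle step at stage $n$ (heads being chosen by an arbitrary strategy); $T_n$ and $T_{n+1}$ are called successive Hydras (at stages $n$ and $n+1$). -}

module Defs where

open import Data.Nat using (ℕ; zero; suc; _+_)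
open import Data.List using (List; []; _∷_; _++_; replicate)
open import Data.Product using (Σ; _×_)
open import Relation.Binary.Construct.Closure.Transitive using (TransClosure)

infixr 5 _∣_

data Term : Set where
  var : ℕ → Term
  h 𝟎 : Term
  I E s : Term → Term
  A B C D _∣_ : Term → Term → Term

subst : (ℕ → Term) → Term → Term
subst σ (var x) = σ x
subst σ h = h
subst σ 𝟎 = 𝟎
subst σ (I t) = I (subst σ t)
subst σ (E t) = E (subst σ t)
subst σ (s t) = s (subst σ t)
subst σ (A t u) = A (subst σ t) (subst σ u)
subst σ (B t u) = B (subst σ t) (subst σ u)
subst σ (C t u) = C (subst σ t) (subst σ u)
subst σ (D t u) = D (subst σ t) (subst σ u)
subst σ (t ∣ u) = subst σ t ∣ subst σ u

private
  n x y : Term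
  n = var 0
  x = var 1
  y = var 2

data Rule : Term → Term → Set where
  r1  : Rule (A n (I h)) (A (s n) h)
  r2  : Rule (A n (I (h ∣ x))) (A (s n) (I x))
  r3  : Rule (A n (I x)) (B n (D (s n) (I x)))
  r4  : Rule (C 𝟎 x) (E x)
  r5  : Rule (C (s n) x) (x ∣ C n x)
  r6  : Rule (I (E x ∣ y)) (E (I (x ∣ y)))
  r7  : Rule (I (E x)) (E (I x))
  r8  : Rule (D n (I (I x))) (I (D n (I x)))
  r9  : Rule (D n (I (I x ∣ y))) (I (D n (I x) ∣ y))
  r10 : Rule (D n (I (I (h ∣ x) ∣ y))) (I (C n (I x) ∣ y))
  r11 : Rule (D n (I (I (h ∣ x)))) (I (C n (I x)))
  r12 : Rule (D n (I (I h ∣ y))) (I (C n h ∣ y))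
  r13 : Rule (D n (I (I h))) (I (C n h))
  r14 : Rule (B n (E x)) (A (s n) x)

infix 4 _⟶_
data _⟶_ : Term → Term → Set where
  root : ∀ {l r} → Rule l r → (σ : ℕ → Term) → subst σ l ⟶ subst σ r
  I-cong : ∀ {t t'} → t ⟶ t' → I t ⟶ I t'
  E-cong : ∀ {t t'} → t ⟶ t' → E t ⟶ E t'
  s-cong : ∀ {t t'} → t ⟶ t' → s t ⟶ s t'
  A-congˡ : ∀ {t t' u} → t ⟶ t' → A t u ⟶ A t' u
  A-congʳ : ∀ {t u u'} → u ⟶ u' → A t u ⟶ A t u'
  B-congˡ : ∀ {t t' u} → t ⟶ t' → B t u ⟶ B t' u
  B-congʳ : ∀ {t u u'} → u ⟶ u' → B t u ⟶ B t u'
  C-congˡ : ∀ {t t' u} → t ⟶ t' → C t u ⟶ C t' u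
  C-congʳ : ∀ {t u u'} → u ⟶ u' → C t u ⟶ C t u'
  D-congˡ : ∀ {t t' u} → t ⟶ t' → D t u ⟶ D t' u
  D-congʳ : ∀ {t u u'} → u ⟶ u' → D t u ⟶ D t u'
  ∣-congˡ : ∀ {t t' u} → t ⟶ t' → (t ∣ u) ⟶ (t' ∣ u)
  ∣-congʳ : ∀ {t u u'} → u ⟶ u' → (t ∣ u) ⟶ (t ∣ u')

infix 4 _=AC_
data _=AC_ : Term → Term → Set where
  refl  : ∀ {t} → t =AC t
  sym   : ∀ {t u} → t =AC u → u =AC t
  trans : ∀ {t u v} → t =AC u → u =AC v → t =AC v
  assoc : ∀ {t u v} → ((t ∣ u) ∣ v) =AC (t ∣ (u ∣ v))
  comm  : ∀ {t u} → (t ∣ u) =AC (u ∣ t)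
  I-cong : ∀ {t t'} → t =AC t' → I t =AC I t'
  E-cong : ∀ {t t'} → t =AC t' → E t =AC E t'
  s-cong : ∀ {t t'} → t =AC t' → s t =AC s t'
  A-cong : ∀ {t t' u u'} → t =AC t' → u =AC u' → A t u =AC A t' u'
  B-cong : ∀ {t t' u u'} → t =AC t' → u =AC u' → B t u =AC B t' u'
  C-cong : ∀ {t t' u u'} → t =AC t' → u =AC u' → C t u =AC C t' u'
  D-cong : ∀ {t t' u u'} → t =AC t' → u =AC u' → D t u =AC D t' u'
  ∣-cong : ∀ {t t' u u'} → t =AC t' → u =AC u' → (t ∣ u) =AC (t' ∣ u')

infix 4 _⟶AC_
_⟶AC_ : Term → Term → Set
t ⟶AC u = Σ Term λ t' → Σ Term λ u' → (t =AC t') × (t' ⟶ u') × (u' =AC u)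

infix 4 _⟶AC⁺_
_⟶AC⁺_ : Term → Term → Set
_⟶AC⁺_ = TransClosure _⟶AC_

numeral : ℕ → Term
numeral zero = 𝟎
numeral (suc k) = s (numeral k)

-- Hydras: finite rooted trees (children listed in some order; the order
-- is irrelevant for everything below)

data Hydra : Set where
  node : List Hydra → Hydra

leaf : Hydra
leaf = node []

mutual
  enc : Hydra → Term
  enc (node []) = h
  enc (node (t ∷ ts)) = I (encs t ts)

  encs : Hydra → List Hydra → Term
  encs t [] = enc t
  encs t (u ∷ us) = enc t ∣ encs u us

-- H is an encoding of T (encodings are exactly the terms AC-equal to
-- the canonical one)
Encodes : Hydra → Term → Set
Encodes T H = H =AC enc T

-- Battle step at stage k where the chopped head's parent p is not the
-- root: g is the root of the tree in 'here', or g is deeper ('there').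
data Grow (k : ℕ) : Hydra → Hydra → Set where
  here  : (xs ys cs ds : List Hydra) →
          Grow k (node (xs ++ node (cs ++ leaf ∷ ds) ∷ ys))
                 (node (xs ++ replicate (2 + k) (node (cs ++ ds)) ++ ys))
  there : ∀ {T T'} (xs ys : List Hydra) → Grow k T T' →
          Grow k (node (xs ++ T ∷ ys)) (node (xs ++ T' ∷ ys))

data Step (k : ℕ) : Hydra → Hydra → Set where
  cut  : (xs ys : List Hydra) →
         Step k (node (xs ++ leaf ∷ ys)) (node (xs ++ ys))
  grow : ∀ {T T'} → Grow k T T' → Step k T T'

-- Occurs k T : T is the Hydra T_k at stage k of some battle T_0, T_1, ...
data Occurs : ℕ → Hydra → Set where
  start : (T : Hydra) → Occurs zero T
  next  : ∀ {k T T'} → Occurs k T → Step k T T' → Occurs (suc k) T'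

-- A cut at the root is rule (2) (or (1)) applied to the encoding with the
-- head moved to the front, which AC allows.  Otherwise rule (3) sends a
-- marker D down, rules (8)/(9) carry it along the path to the grandparent
-- of the chopped head, rules (10)–(13) delete the head and spawn
-- C(s^(k+1) 0, P), which rules (5)/(4) unfold into k + 1 copies of P next to
-- E(P); rules (6)/(7) float that E up to the root, its P becoming the
-- (k+2)-th copy, and rule (14) restores the A with counter s^(k+1) 0.
module Submission where

open import Defs
open import Data.Nat using (ℕ; zero; suc; _+_)
open import Data.Product using (∃; Σ-syntax; _,_)
open import Data.Maybe using (Maybe; just; nothing)
open import Data.Maybe.Relation.Binary.Pointwise as Pointwise
  using (Pointwise; just; nothing)
open import Data.List using (List; []; _∷_; _++_; replicate)
open import Data.List.Relation.Binary.Permutation.Propositional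
  using (_↭_; refl; prep; swap; trans)
open import Data.List.Relation.Binary.Permutation.Propositional.Properties
  using (shifts)
open import Relation.Binary.PropositionalEquality as ≡ using (_≡_)
open import Relation.Binary.Construct.Closure.Transitive
  using ([_]; _∷_)

private
  variable
    t t′ u u′ v : Term

=AC-reflexive : t ≡ u → t =AC u
=AC-reflexive ≡.refl = refl

∣-swap : (t ∣ (u ∣ v)) =AC (u ∣ (t ∣ v))
∣-swap = trans (sym assoc) (trans (∣-cong comm refl) assoc)

⟶⇒⟶AC⁺ : t ⟶ u → t ⟶AC⁺ u
⟶⇒⟶AC⁺ r = [ _ , _ , refl , r , refl ]

=AC-⟶AC⁺-trans : t =AC t′ → t′ ⟶AC⁺ u → t ⟶AC⁺ u
=AC-⟶AC⁺-trans e [ _ , _ , e₁ , r , e₂ ]       = [ _ , _ , trans e e₁ , r , e₂ ]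
=AC-⟶AC⁺-trans e ((_ , _ , e₁ , r , e₂) ∷ rs) = (_ , _ , trans e e₁ , r , e₂) ∷ rs

⟶AC⁺-=AC-trans : t ⟶AC⁺ u → u =AC u′ → t ⟶AC⁺ u′
⟶AC⁺-=AC-trans [ _ , _ , e₁ , r , e₂ ] e = [ _ , _ , e₁ , r , trans e₂ e ]
⟶AC⁺-=AC-trans (step ∷ rs)            e = step ∷ ⟶AC⁺-=AC-trans rs e

⟶AC⁺-trans : t ⟶AC⁺ u → u ⟶AC⁺ v → t ⟶AC⁺ v
⟶AC⁺-trans [ step ]    rs′ = step ∷ rs′
⟶AC⁺-trans (step ∷ rs) rs′ = step ∷ ⟶AC⁺-trans rs rs′

⟶AC⁺-cong : (F : Term → Term) →
            (∀ {a b} → a =AC b → F a =AC F b) → (∀ {a b} → a ⟶ b → F a ⟶ F b) →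
            t ⟶AC⁺ u → F t ⟶AC⁺ F u
⟶AC⁺-cong F =AC-F ⟶-F [ _ , _ , e₁ , r , e₂ ] =
  [ _ , _ , =AC-F e₁ , ⟶-F r , =AC-F e₂ ]
⟶AC⁺-cong F =AC-F ⟶-F ((_ , _ , e₁ , r , e₂) ∷ rs) =
  (_ , _ , =AC-F e₁ , ⟶-F r , =AC-F e₂) ∷ ⟶AC⁺-cong F =AC-F ⟶-F rs

module ⟶AC⁺-Reasoning where

  data Chain (t u : Term) : Set where
    equals  : t =AC u → Chain t u
    reduces : t ⟶AC⁺ u → Chain t u

  data IsReduction {t u : Term} : Chain t u → Set where
    instance isReduction : ∀ {r} → IsReduction (reduces r)

  infix  1 begin_
  infixr 2 _≈⟨_⟩_ _≡⟨⟩_ _⟶⟨_⟩_ _⟶⁺⟨_⟩_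
  infix  3 _∎

  begin_ : (c : Chain t u) → {{IsReduction c}} → t ⟶AC⁺ u
  begin_ .(reduces r) {{isReduction {r}}} = r

  _≈⟨_⟩_ : ∀ t → t =AC t′ → Chain t′ u → Chain t u
  t ≈⟨ e ⟩ equals e′  = equals (trans e e′)
  t ≈⟨ e ⟩ reduces rs = reduces (=AC-⟶AC⁺-trans e rs)

  _≡⟨⟩_ : ∀ t → Chain t u → Chain t u
  t ≡⟨⟩ c = c

  _⟶⁺⟨_⟩_ : ∀ t → t ⟶AC⁺ t′ → Chain t′ u → Chain t u
  t ⟶⁺⟨ rs ⟩ equals e    = reduces (⟶AC⁺-=AC-trans rs e)
  t ⟶⁺⟨ rs ⟩ reduces rs′ = reduces (⟶AC⁺-trans rs rs′)

  _⟶⟨_⟩_ : ∀ t → t ⟶ t′ → Chain t′ u → Chain t u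
  t ⟶⟨ r ⟩ c = t ⟶⁺⟨ ⟶⇒⟶AC⁺ r ⟩ c

  _∎ : ∀ t → Chain t t
  t ∎ = equals refl

open ⟶AC⁺-Reasoning

⟨_,_,_⟩ : Term → Term → Term → ℕ → Term
⟨ n , x , y ⟩ zero          = n
⟨ n , x , y ⟩ (suc zero)    = x
⟨ n , x , y ⟩ (suc (suc _)) = y

rule : ∀ {l r} → Rule l r → (n x y : Term) → subst ⟨ n , x , y ⟩ l ⟶ subst ⟨ n , x , y ⟩ r
rule ρ n x y = root ρ ⟨ n , x , y ⟩

-- Most rules of H come in two versions, with and without a sibling
-- context y; with t ∣? nothing = t, each lemma below covers both.
infixr 5 _∣?_
_∣?_ : Term → Maybe Term → Term
t ∣? nothing = t
t ∣? just u  = t ∣ u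

I? : Maybe Term → Term
I? nothing  = h
I? (just t) = I t

∣?-congˡ : ∀ m → t =AC u → (t ∣? m) =AC (u ∣? m)
∣?-congˡ nothing  e = e
∣?-congˡ (just _) e = ∣-cong e refl

⟶-∣?-congˡ : ∀ m → t ⟶ u → (t ∣? m) ⟶ (u ∣? m)
⟶-∣?-congˡ nothing  r = r
⟶-∣?-congˡ (just _) r = ∣-congˡ r

∣?-assoc : ∀ m → ((t ∣ u) ∣? m) =AC (t ∣ (u ∣? m))
∣?-assoc nothing  = refl
∣?-assoc (just _) = assoc

⟶AC⁺-I∣?-cong : ∀ m → t ⟶AC⁺ u → I (t ∣? m) ⟶AC⁺ I (u ∣? m)
⟶AC⁺-I∣?-cong m =
  ⟶AC⁺-cong (λ t → I (t ∣? m)) (λ e → I-cong (∣?-congˡ m e)) (λ r → I-cong (⟶-∣?-congˡ m r))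

A-chop : ∀ n m → A n (I (h ∣? m)) ⟶ A (s n) (I? m)
A-chop n nothing  = rule r1 n h h
A-chop n (just x) = rule r2 n x h

E-float : ∀ x m → I (E x ∣? m) ⟶ E (I (x ∣? m))
E-float x nothing  = rule r7 h x h
E-float x (just y) = rule r6 h x y

D-descend : ∀ n u m → D n (I (I u ∣? m)) ⟶ I (D n (I u) ∣? m)
D-descend n u nothing  = rule r8 n u h
D-descend n u (just y) = rule r9 n u y

D-chop : ∀ n q m → D n (I (I (h ∣? q) ∣? m)) ⟶ I (C n (I? q) ∣? m)
D-chop n nothing  nothing  = rule r13 n h h
D-chop n nothing  (just y) = rule r12 n h y
D-chop n (just x) nothing  = rule r11 n x h
D-chop n (just x) (just y) = rule r10 n x y

copies : ℕ → Term → Term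
copies zero    x = x
copies (suc j) x = x ∣ copies j x

C-unfold : ∀ j x → C (numeral (suc j)) x ⟶AC⁺ (E x ∣ copies j x)
C-unfold zero x = begin
  C (s 𝟎) x  ⟶⟨ rule r5 𝟎 x h ⟩
  x ∣ C 𝟎 x  ⟶⟨ ∣-congʳ (rule r4 h x h) ⟩
  x ∣ E x    ≈⟨ comm ⟩
  E x ∣ x    ∎
C-unfold (suc j) x = begin
  C (numeral (suc (suc j))) x          ⟶⟨ rule r5 (numeral (suc j)) x h ⟩
  x ∣ C (numeral (suc j)) x            ⟶⁺⟨ ⟶AC⁺-cong (x ∣_) (∣-cong refl) ∣-congʳ (C-unfold j x) ⟩
  x ∣ (E x ∣ copies j x)               ≈⟨ ∣-swap ⟩
  E x ∣ copies (suc j) x               ∎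

encForest : List Hydra → Maybe Term
encForest []       = nothing
encForest (t ∷ ts) = just (encs t ts)

infix 4 _≈ᶠ_
_≈ᶠ_ : Maybe Term → Maybe Term → Set
_≈ᶠ_ = Pointwise _=AC_

enc-node : ∀ ts → enc (node ts) ≡ I? (encForest ts)
enc-node []      = ≡.refl
enc-node (_ ∷ _) = ≡.refl

encs-∣? : ∀ t ts → encs t ts ≡ enc t ∣? encForest ts
encs-∣? t []      = ≡.refl
encs-∣? t (_ ∷ _) = ≡.refl

encs-cong : ∀ t {xs ys} → encForest xs ≈ᶠ encForest ys → encs t xs =AC encs t ys
encs-cong t {[]}    {[]}    _        = refl
encs-cong t {_ ∷ _} {_ ∷ _} (just e) = ∣-cong refl e

encs-swap : ∀ t u {xs ys} → encForest xs ≈ᶠ encForest ys →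
            (enc t ∣ encs u xs) =AC (enc u ∣ encs t ys)
encs-swap t u {[]}    {[]}    _        = comm
encs-swap t u {_ ∷ _} {_ ∷ _} (just e) = trans ∣-swap (∣-cong refl (∣-cong refl e))

encForest-↭ : ∀ {xs ys} → xs ↭ ys → encForest xs ≈ᶠ encForest ys
encForest-↭ refl          = Pointwise.refl refl
encForest-↭ (prep t p)    = just (encs-cong t (encForest-↭ p))
encForest-↭ (swap t u p)  = just (encs-swap t u (encForest-↭ p))
encForest-↭ (trans p₁ p₂) = Pointwise.trans trans (encForest-↭ p₁) (encForest-↭ p₂)

I?-cong : ∀ {m m′} → m ≈ᶠ m′ → I? m =AC I? m′
I?-cong (just e) = I-cong e
I?-cong nothing  = refl

enc-node-↭ : ∀ {xs ys} → xs ↭ ys → enc (node xs) =AC enc (node ys)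
enc-node-↭ {xs} {ys} p =
  trans (=AC-reflexive (enc-node xs)) (trans (I?-cong (encForest-↭ p)) (sym (=AC-reflexive (enc-node ys))))

encs-++ : ∀ t ts us → encs t (ts ++ us) =AC (encs t ts ∣? encForest us)
encs-++ t []       us = =AC-reflexive (encs-∣? t us)
encs-++ t (u ∷ ts) us =
  trans (∣-cong refl (encs-++ u ts us)) (sym (∣?-assoc (encForest us)))

enc-node-focus : ∀ xs t ts ys →
                 enc (node (xs ++ (t ∷ ts) ++ ys)) =AC I (encs t ts ∣? encForest (xs ++ ys))
enc-node-focus xs t ts ys =
  trans (enc-node-↭ (shifts xs (t ∷ ts))) (I-cong (encs-++ t ts (xs ++ ys)))

encs-replicate : ∀ j P → encs P (replicate j P) ≡ copies j (enc P)
encs-replicate zero    P = ≡.refl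
encs-replicate (suc j) P = ≡.cong (enc P ∣_) (encs-replicate j P)

Grow⇒enc≡I : ∀ {k T T′} → Grow k T T′ → Σ[ u ∈ Term ] enc T ≡ I u
Grow⇒enc≡I (here []      _ _ _) = _ , ≡.refl
Grow⇒enc≡I (here (_ ∷ _) _ _ _) = _ , ≡.refl
Grow⇒enc≡I (there []      _ _)  = _ , ≡.refl
Grow⇒enc≡I (there (_ ∷ _) _ _)  = _ , ≡.refl

D-Grow : ∀ {k T T′} → Grow k T T′ → D (numeral (suc k)) (enc T) ⟶AC⁺ E (enc T′)
D-Grow {k} (here xs ys cs ds) = begin
  D N (enc (node (xs ++ p ∷ ys)))               ≈⟨ D-cong refl (enc-node-focus xs p [] ys) ⟩
  D N (I (enc p ∣? rest))                       ≈⟨ D-cong refl (I-cong (∣?-congˡ rest p-focus)) ⟩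
  D N (I (I (h ∣? encForest (cs ++ ds)) ∣? rest)) ⟶⟨ D-chop N (encForest (cs ++ ds)) rest ⟩
  I (C N (I? (encForest (cs ++ ds))) ∣? rest)   ≈⟨ I-cong (∣?-congˡ rest (C-cong refl P-enc)) ⟩
  I (C N x ∣? rest)                             ⟶⁺⟨ ⟶AC⁺-I∣?-cong rest (C-unfold k x) ⟩
  I ((E x ∣ copies k x) ∣? rest)                ≈⟨ I-cong (∣?-assoc rest) ⟩
  I (E x ∣ (copies k x ∣? rest))                ⟶⟨ E-float x (just (copies k x ∣? rest)) ⟩
  E (I (x ∣ (copies k x ∣? rest)))              ≈⟨ E-cong (I-cong (sym copies-rest)) ⟩
  E (I (encs P (replicate (suc k) P) ∣? rest))  ≈⟨ E-cong (sym (enc-node-focus xs P (replicate (suc k) P) ys)) ⟩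
  E (enc (node (xs ++ replicate (2 + k) P ++ ys))) ∎
  where
  N = numeral (suc k)
  p = node (cs ++ leaf ∷ ds)
  P = node (cs ++ ds)
  x = enc P
  rest = encForest (xs ++ ys)
  p-focus : enc p =AC I (h ∣? encForest (cs ++ ds))
  p-focus = enc-node-focus cs leaf [] ds
  P-enc : I? (encForest (cs ++ ds)) =AC x
  P-enc = sym (=AC-reflexive (enc-node (cs ++ ds)))
  copies-rest : (encs P (replicate (suc k) P) ∣? rest) =AC (x ∣ (copies k x ∣? rest))
  copies-rest = trans (∣?-congˡ rest (∣-cong refl (=AC-reflexive (encs-replicate k P)))) (∣?-assoc rest)
D-Grow {k} (there {T} {T′} xs ys g) with Grow⇒enc≡I g | D-Grow g
... | u , enc-T≡Iu | D-g = begin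
  D N (enc (node (xs ++ T ∷ ys)))   ≈⟨ D-cong refl (enc-node-focus xs T [] ys) ⟩
  D N (I (enc T ∣? rest))           ≈⟨ D-cong refl (I-cong (∣?-congˡ rest (=AC-reflexive enc-T≡Iu))) ⟩
  D N (I (I u ∣? rest))             ⟶⟨ D-descend N u rest ⟩
  I (D N (I u) ∣? rest)             ⟶⁺⟨ ⟶AC⁺-I∣?-cong rest (≡.subst (λ t → D N t ⟶AC⁺ E (enc T′)) enc-T≡Iu D-g) ⟩
  I (E (enc T′) ∣? rest)            ⟶⟨ E-float (enc T′) rest ⟩
  E (I (enc T′ ∣? rest))            ≈⟨ E-cong (sym (enc-node-focus xs T′ [] ys)) ⟩
  E (enc (node (xs ++ T′ ∷ ys)))    ∎
  where
  N = numeral (suc k)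
  rest = encForest (xs ++ ys)

A-Step : ∀ {k T T′} → Step k T T′ → A (numeral k) (enc T) ⟶AC⁺ A (numeral (suc k)) (enc T′)
A-Step {k} (cut xs ys) = begin
  A (numeral k) (enc (node (xs ++ leaf ∷ ys)))   ≈⟨ A-cong refl (enc-node-focus xs leaf [] ys) ⟩
  A (numeral k) (I (h ∣? encForest (xs ++ ys)))  ⟶⟨ A-chop (numeral k) (encForest (xs ++ ys)) ⟩
  A (numeral (suc k)) (I? (encForest (xs ++ ys))) ≈⟨ A-cong refl (sym (=AC-reflexive (enc-node (xs ++ ys)))) ⟩
  A (numeral (suc k)) (enc (node (xs ++ ys)))    ∎
A-Step {k} {T} {T′} (grow g) with Grow⇒enc≡I g
... | u , enc-T≡Iu = begin
  A (numeral k) (enc T)                         ≈⟨ A-cong refl (=AC-reflexive enc-T≡Iu) ⟩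
  A (numeral k) (I u)                           ⟶⟨ rule r3 (numeral k) u h ⟩
  B (numeral k) (D (numeral (suc k)) (I u))     ≈⟨ B-cong refl (D-cong refl (sym (=AC-reflexive enc-T≡Iu))) ⟩
  B (numeral k) (D (numeral (suc k)) (enc T))   ⟶⁺⟨ ⟶AC⁺-cong (B (numeral k)) (B-cong refl) B-congʳ (D-Grow g) ⟩
  B (numeral k) (E (enc T′))                    ⟶⟨ rule r14 (numeral k) (enc T′) h ⟩
  A (numeral (suc k)) (enc T′)                  ∎

-- The battle history (Occurs) is irrelevant: any step at stage k is
-- simulated with counter s^k(0).
theorem3p4 : (k : ℕ) (T T' : Hydra) → Occurs k T → Step k T T' →
             (H H' : Term) → Encodes T H → Encodes T' H' →
             ∃ λ m → A (numeral m) H ⟶AC⁺ A (s (numeral m)) H'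
theorem3p4 k T T' _ step H H' H≈T H'≈T' =
  k , (begin
    A (numeral k) H               ≈⟨ A-cong refl H≈T ⟩
    A (numeral k) (enc T)         ⟶⁺⟨ A-Step step ⟩
    A (numeral (suc k)) (enc T')  ≈⟨ A-cong refl (sym H'≈T') ⟩
    A (s (numeral k)) H'          ∎)
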